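{- The $\pi^{MPM}$-calculus is weakly replacement free, i.e. it is replacement free but not strongly replacement free.
   Context: The $\pi^{MPM}$-calculus extends the $\pi$-calculus simultaneously with match, polyadic synchronization and pattern matching. Syntax: $P,Q ::= 0 \mid \mu.P \mid P+Q \mid P\mid Q \mid (\nu n)P \mid\, !P \mid [n=m]P$ and $\mu ::= \tau \mid \tilde a(\tilde x) \mid \overline{\tilde a}\langle \tilde n\rangle$. Here $[n=m]P$ behaves as $P$ if the names $n$ and $m$ coincide and is stuck otherwise; the subjects of input and output are tuples of names $\tilde a$, and an input and output can synchronize only if their subject tuples coincide; the object of an input is a pattern, a tuple of names some of which are marked $\lceil x\rceil$ (such names stand for themselves and are not affected by substitutions, $\lceil x\rceil\sigma=\lceil x\rceil$), while the others are placeholders; a pattern $\tilde x$ matches a tuple $\tilde b$ of the same length if there is a least substitution $\sigma$ with $\tilde x\sigma=\tilde b$ (after removing the marks), in which case $\tilde a(\tilde x).P \mid \overline{\tilde a}\langle\tilde b\rangle.Q \xrightarrow{\tau} P\sigma\mid Q$. The rest of the labelled transition semantics is as in the $\pi$-calculus; actions other than $\tau$ are visible. $\mathrm{fn}(P)$ is the set of free names; $P$ is closed if $\mathrm{fn}(P)=\emptyset$. A context is a term with one hole. $\Rightarrow$ is the reflexive-transitive closure of $\xrightarrow{\tau}$; $P\Downarrow$ iff $P\Rightarrow\xrightarrow{\alpha}\Rightarrow P'$ for some visible $\alpha$ and $P'$; $P$ is invisible iff not $P\Downarrow$. A calculus is strongly replacement free if for every context $C$, invisible process $I$ and process $P$,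 $C[I]\Downarrow$ implies $C[P]\Downarrow$; it is replacement free if this holds for every context $C$, closed invisible process $I$ and process $P$. -}

module Defs where

open import Data.Nat using (ℕ; zero; suc; _+_; _<_)
open import Data.Fin using (Fin)
import Data.Fin as F
open import Data.List using (List; []; _∷_; map)
open import Data.List.NonEmpty as L⁺ using (List⁺)
open import Data.List.Relation.Unary.All using (All)
open import Data.List.Relation.Unary.Any using (Any; here; there)
open import Data.List.Relation.Binary.Pointwise using (Pointwise)
open import Data.Product using (∃; _×_; _,_)
open import Relation.Binary.PropositionalEquality using (_≡_; refl)
open import Relation.Nullary using (¬_)
open import Data.Unit using (⊤)

-- Names: de Bruijn indices.  A name i occurring under d binders is bound
-- if i < d and denotes the free name (i - d) otherwise.

Name : Set
Name = ℕ

-- A pattern element is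
-- either a marked name ⌈n⌉ (a name of the enclosing scope, standing for
-- itself) or a placeholder (one of the k names bound by the input;
-- placeholder j is de Bruijn index j in the continuation).  Placeholders
-- may be repeated.
data PatEl (k : ℕ) : Set where
  mark : Name → PatEl k
  var  : Fin k → PatEl k

Pattern : ℕ → Set
Pattern k = List (PatEl k)

-- In the named syntax, the names bound by an input are exactly the
-- unmarked names of its pattern: every bound placeholder occurs.
Covers : {k : ℕ} → Pattern k → Set
Covers {k} pat = (j : Fin k) → Any (var j ≡_) pat

data Proc : Set where
  𝟘     : Proc
  τ·_   : Proc → Proc
  out   : List⁺ Name → List Name → Proc → Proc
  inp   : List⁺ Name → (k : ℕ) → (pat : Pattern k) → Covers pat → Proc → Proc
  _⊕_   : Proc → Proc → Proc
  _∥_   : Proc → Proc → Proc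
  ν_    : Proc → Proc
  !_    : Proc → Proc
  [_≐_]_ : Name → Name → Proc → Proc

ext : (ℕ → ℕ) → ℕ → ℕ
ext ρ zero    = zero
ext ρ (suc i) = suc (ρ i)

extN : ℕ → (ℕ → ℕ) → ℕ → ℕ
extN zero    ρ = ρ
extN (suc k) ρ = ext (extN k ρ)

renEl : {k : ℕ} → (ℕ → ℕ) → PatEl k → PatEl k
renEl ρ (mark n) = mark (ρ n)
renEl ρ (var j)  = var j

renCovers : {k : ℕ} (ρ : ℕ → ℕ) (pat : Pattern k) → Covers pat → Covers (map (renEl ρ) pat)
renCovers ρ pat c j = go pat (c j)
  where
  go : (p : Pattern _) → Any (var j ≡_) p → Any (var j ≡_) (map (renEl ρ) p)
  go (.(var j) ∷ p) (here refl) = here refl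
  go (x ∷ p)        (there a)   = there (go p a)

ren : (ℕ → ℕ) → Proc → Proc
ren ρ 𝟘               = 𝟘
ren ρ (τ· P)          = τ· ren ρ P
ren ρ (out a b P)     = out (L⁺.map ρ a) (map ρ b) (ren ρ P)
ren ρ (inp a k pat c P) =
  inp (L⁺.map ρ a) k (map (renEl ρ) pat) (renCovers ρ pat c) (ren (extN k ρ) P)
ren ρ (P ⊕ Q)         = ren ρ P ⊕ ren ρ Q
ren ρ (P ∥ Q)         = ren ρ P ∥ ren ρ Q
ren ρ (ν P)           = ν ren (ext ρ) P
ren ρ (! P)           = ! ren ρ P
ren ρ ([ n ≐ m ] P)   = [ ρ n ≐ ρ m ] ren ρ P

shift : ℕ → ℕ → ℕ
shift k i = k + i

liftAt : ℕ → ℕ → ℕ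
liftAt zero    i       = suc i
liftAt (suc k) zero    = zero
liftAt (suc k) (suc i) = suc (liftAt k i)

-- rot k: move index k to index 0, indices 0..k-1 up by one, others fixed
rot : ℕ → ℕ → ℕ
rot zero    i       = i
rot (suc k) zero    = suc zero
rot (suc k) (suc i) = bump (rot k i)
  where
  bump : ℕ → ℕ
  bump zero    = zero
  bump (suc j) = suc (suc j)

-- the substitution applied to the continuation of an input binding k
-- placeholders that received σ : placeholder j ↦ σ j, others lowered by k
inst : (k : ℕ) → (Fin k → Name) → ℕ → ℕ
inst zero    σ i       = i
inst (suc k) σ zero    = σ F.zero
inst (suc k) σ (suc i) = inst k (λ j → σ (F.suc j)) i

νs : ℕ → Proc → Proc
νs zero    P = P
νs (suc k) P = ν νs k P

-- Pattern matching: σ is the (least, i.e. defined exactly on the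
-- placeholders) substitution with pat σ = b̃.

MatchEl : {k : ℕ} → (Fin k → Name) → PatEl k → Name → Set
MatchEl σ (mark n) b = b ≡ n
MatchEl σ (var j)  b = b ≡ σ j

Match : {k : ℕ} → (Fin k → Name) → Pattern k → List Name → Set
Match σ pat b = Pointwise (MatchEl σ) pat b

-- Actions (early semantics).
--   τ
--   inA ã b̃      : input of b̃ on subject ã
--   outA k ã b̃   : output on ã of b̃, extruding k bound names
--                   (k = 0: free output).  ã is in the outer scope,
--                   b̃ and the residual in the scope extended by the k
--                   extruded names (indices 0..k-1).

data Act : Set where
  τ    : Act
  inA  : List⁺ Name → List Name → Act
  outA : ℕ → List⁺ Name → List Name → Act

Visible : Act → Set
Visible α = ¬ (α ≡ τ)

bn : Act → ℕ
bn τ            = 0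
bn (inA _ _)    = 0
bn (outA k _ _) = k

infix 4 _—[_]→_
data _—[_]→_ : Proc → Act → Proc → Set where
  tau   : ∀ {P} → (τ· P) —[ τ ]→ P
  output : ∀ {a b P} → out a b P —[ outA 0 a b ]→ P
  input : ∀ {a k pat c P b} (σ : Fin k → Name) → Match σ pat b →
          inp a k pat c P —[ inA a b ]→ ren (inst k σ) P
  sumL  : ∀ {P Q α P'} → P —[ α ]→ P' → (P ⊕ Q) —[ α ]→ P'
  sumR  : ∀ {P Q α Q'} → Q —[ α ]→ Q' → (P ⊕ Q) —[ α ]→ Q'
  parL  : ∀ {P Q α P'} → P —[ α ]→ P' → (P ∥ Q) —[ α ]→ (P' ∥ ren (shift (bn α)) Q)
  parR  : ∀ {P Q α Q'} → Q —[ α ]→ Q' → (P ∥ Q) —[ α ]→ (ren (shift (bn α)) P ∥ Q')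
  commL : ∀ {P Q P' Q' k a b} →
          P —[ outA k a b ]→ P' →
          ren (shift k) Q —[ inA (L⁺.map (shift k) a) b ]→ Q' →
          (P ∥ Q) —[ τ ]→ νs k (P' ∥ Q')
  commR : ∀ {P Q P' Q' k a b} →
          Q —[ outA k a b ]→ Q' →
          ren (shift k) P —[ inA (L⁺.map (shift k) a) b ]→ P' →
          (P ∥ Q) —[ τ ]→ νs k (P' ∥ Q')
  resτ  : ∀ {P P'} → P —[ τ ]→ P' → (ν P) —[ τ ]→ (ν P')
  resIn : ∀ {P P' a b} → P —[ inA (L⁺.map suc a) (map suc b) ]→ P' →
          (ν P) —[ inA a b ]→ (ν P')
  resOut : ∀ {P P' k a b} →
          P —[ outA k (L⁺.map suc a) (map (liftAt k) b) ]→ P' →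
          (ν P) —[ outA k a b ]→ (ν ren (rot k) P')
  open′ : ∀ {P P' k a b} →
          P —[ outA k (L⁺.map suc a) b ]→ P' → Any (_≡ k) b →
          (ν P) —[ outA (suc k) a b ]→ P'
  rep   : ∀ {P α P'} → (P ∥ (! P)) —[ α ]→ P' → (! P) —[ α ]→ P'
  match : ∀ {n P α P'} → P —[ α ]→ P' → ([ n ≐ n ] P) —[ α ]→ P'

infix 4 _⇒_
data _⇒_ : Proc → Proc → Set where
  ε   : ∀ {P} → P ⇒ P
  _◅_ : ∀ {P Q R} → P —[ τ ]→ Q → Q ⇒ R → P ⇒ R

_⇓ : Proc → Set
P ⇓ = ∃ λ Q → ∃ λ α → ∃ λ Q' → ∃ λ P' →
        P ⇒ Q × Q —[ α ]→ Q' × Visible α × Q' ⇒ P'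

Invisible : Proc → Set
Invisible P = ¬ (P ⇓)

ScopedEl : {k : ℕ} → ℕ → PatEl k → Set
ScopedEl n (mark m) = m < n
ScopedEl n (var j)  = ⊤

data Scoped (n : ℕ) : Proc → Set where
  𝟘     : Scoped n 𝟘
  τ·_   : ∀ {P} → Scoped n P → Scoped n (τ· P)
  out   : ∀ {a b P} → All (_< n) (L⁺.toList a) → All (_< n) b → Scoped n P →
          Scoped n (out a b P)
  inp   : ∀ {a k pat c P} → All (_< n) (L⁺.toList a) → All (ScopedEl n) pat →
          Scoped (k + n) P → Scoped n (inp a k pat c P)
  _⊕_   : ∀ {P Q} → Scoped n P → Scoped n Q → Scoped n (P ⊕ Q)
  _∥_   : ∀ {P Q} → Scoped n P → Scoped n Q → Scoped n (P ∥ Q)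
  ν_    : ∀ {P} → Scoped (suc n) P → Scoped n (ν P)
  !_    : ∀ {P} → Scoped n P → Scoped n (! P)
  [_≐_]_ : ∀ {m m' P} → m < n → m' < n → Scoped n P → Scoped n ([ m ≐ m' ] P)

Closed : Proc → Set
Closed P = Scoped 0 P

-- Contexts: terms with exactly one hole (hole capture is allowed, the
-- hole is filled literally).

data Ctx : Set where
  ∙      : Ctx
  τ·_    : Ctx → Ctx
  out    : List⁺ Name → List Name → Ctx → Ctx
  inp    : List⁺ Name → (k : ℕ) → (pat : Pattern k) → Covers pat → Ctx → Ctx
  _⊕ˡ_   : Ctx → Proc → Ctx
  _⊕ʳ_   : Proc → Ctx → Ctx
  _∥ˡ_   : Ctx → Proc → Ctx
  _∥ʳ_   : Proc → Ctx → Ctx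
  ν_     : Ctx → Ctx
  !_     : Ctx → Ctx
  [_≐_]_ : Name → Name → Ctx → Ctx

_[_] : Ctx → Proc → Proc
∙ [ P ]                 = P
(τ· C) [ P ]            = τ· (C [ P ])
out a b C [ P ]         = out a b (C [ P ])
inp a k pat c C [ P ]   = inp a k pat c (C [ P ])
(C ⊕ˡ Q) [ P ]          = (C [ P ]) ⊕ Q
(Q ⊕ʳ C) [ P ]          = Q ⊕ (C [ P ])
(C ∥ˡ Q) [ P ]          = (C [ P ]) ∥ Q
(Q ∥ʳ C) [ P ]          = Q ∥ (C [ P ])
(ν C) [ P ]             = ν (C [ P ])
(! C) [ P ]             = ! (C [ P ])
([ n ≐ m ] C) [ P ]     = [ n ≐ m ] (C [ P ])

StronglyReplacementFree : Set
StronglyReplacementFree =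
  (C : Ctx) (I P : Proc) → Invisible I → (C [ I ]) ⇓ → (C [ P ]) ⇓

ReplacementFree : Set
ReplacementFree =
  (C : Ctx) (I P : Proc) → Closed I → Invisible I → (C [ I ]) ⇓ → (C [ P ]) ⇓

WeaklyReplacementFree : Set
WeaklyReplacementFree = ReplacementFree × ¬ StronglyReplacementFree

-- A closed invisible process can be neither observed nor activated by its
-- context: a renaming (the only way a context acts on a subprocess, through
-- input substitution or scope extrusion) fixes every closed process, so the
-- descendants of C[I] stay related to those of C[P] by a relation in which
-- closed invisible processes of the left side face arbitrary processes on the
-- right.  The left side's τ-steps inside such holes are invisible and are
-- left unanswered, every other step is answered by the right side, so each
-- barb of C[I] is a barb of C[P].  Closedness is essential: in
-- (νa)(a(x).[x = b] b̄ | ā⟨b⟩) the invisible [x = b] b̄ becomes observable,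
-- while (νa)(a(x).0 | ā⟨b⟩) has no barb.
module Submission where

open import Defs
open import Data.Nat using (ℕ; zero; suc; _+_; _<_; s≤s; z≤n)
open import Data.Nat.Properties using (+-suc; +-monoʳ-<)
open import Data.Fin using (Fin)
import Data.Fin as F
open import Data.List using ([]; _∷_)
open import Data.List.Properties using (map-id; map-cong; map-id-local)
open import Data.List.NonEmpty as L⁺ using (List⁺; toList)
import Data.List.NonEmpty.Properties as L⁺
open import Data.List.Relation.Unary.All as All using (All; []; _∷_)
open import Data.List.Relation.Unary.All.Properties using (map⁺; map⁻)
open import Data.List.Relation.Unary.Any using (Any; here; there)
open import Data.List.Relation.Binary.Pointwise using ([]; _∷_)
open import Data.Product using (∃; _×_; _,_)
open import Data.Sum using (_⊎_; inj₁; inj₂)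
open import Data.Empty using (⊥-elim)
open import Data.Unit using (⊤; tt)
open import Function using (id)
open import Relation.Nullary using (¬_)
open import Relation.Binary.PropositionalEquality
  using (_≡_; refl; sym; trans; cong; cong₂; subst; _≗_)

-- Syntactic equality up to the Covers witnesses of inputs.  Renaming rebuilds
-- these witnesses, so renamings fix closed processes only up to ≈.
infix 4 _≈_
data _≈_ : Proc → Proc → Set where
  𝟘     : 𝟘 ≈ 𝟘
  τ·_   : ∀ {P Q} → P ≈ Q → (τ· P) ≈ (τ· Q)
  out   : ∀ {a a' b b' P Q} → a ≡ a' → b ≡ b' → P ≈ Q → out a b P ≈ out a' b' Q
  inp   : ∀ {a a' k pat pat' c c' P Q} → a ≡ a' → pat ≡ pat' → P ≈ Q →
          inp a k pat c P ≈ inp a' k pat' c' Q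
  _⊕_   : ∀ {P P' Q Q'} → P ≈ P' → Q ≈ Q' → (P ⊕ Q) ≈ (P' ⊕ Q')
  _∥_   : ∀ {P P' Q Q'} → P ≈ P' → Q ≈ Q' → (P ∥ Q) ≈ (P' ∥ Q')
  ν_    : ∀ {P Q} → P ≈ Q → (ν P) ≈ (ν Q)
  !_    : ∀ {P Q} → P ≈ Q → (! P) ≈ (! Q)
  [_≐_]_ : ∀ {n n' m m' P Q} → n ≡ n' → m ≡ m' → P ≈ Q → ([ n ≐ m ] P) ≈ ([ n' ≐ m' ] Q)

≈-refl : ∀ {P} → P ≈ P
≈-refl {𝟘}               = 𝟘
≈-refl {τ· P}            = τ· ≈-refl
≈-refl {out a b P}       = out refl refl ≈-refl
≈-refl {inp a k pat c P} = inp refl refl ≈-refl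
≈-refl {P ⊕ Q}           = ≈-refl ⊕ ≈-refl
≈-refl {P ∥ Q}           = ≈-refl ∥ ≈-refl
≈-refl {ν P}             = ν ≈-refl
≈-refl { ! P }           = ! ≈-refl
≈-refl {[ n ≐ m ] P}     = [ refl ≐ refl ] ≈-refl

≈-trans : ∀ {P Q R} → P ≈ Q → Q ≈ R → P ≈ R
≈-trans 𝟘              𝟘                 = 𝟘
≈-trans (τ· e)         (τ· f)            = τ· ≈-trans e f
≈-trans (out p q e)    (out p' q' f)     = out (trans p p') (trans q q') (≈-trans e f)
≈-trans (inp p q e)    (inp p' q' f)     = inp (trans p p') (trans q q') (≈-trans e f)
≈-trans (e ⊕ f)        (e' ⊕ f')         = ≈-trans e e' ⊕ ≈-trans f f'
≈-trans (e ∥ f)        (e' ∥ f')         = ≈-trans e e' ∥ ≈-trans f f'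
≈-trans (ν e)          (ν f)             = ν ≈-trans e f
≈-trans (! e)          (! f)             = ! ≈-trans e f
≈-trans ([ p ≐ q ] e)  ([ p' ≐ q' ] f)   = [ trans p p' ≐ trans q q' ] ≈-trans e f

≈-ren : ∀ ρ {P Q} → P ≈ Q → ren ρ P ≈ ren ρ Q
≈-ren ρ 𝟘                         = 𝟘
≈-ren ρ (τ· e)                    = τ· ≈-ren ρ e
≈-ren ρ (out refl refl e)         = out refl refl (≈-ren ρ e)
≈-ren ρ (inp {k = k} refl refl e) = inp refl refl (≈-ren (extN k ρ) e)
≈-ren ρ (e ⊕ f)                   = ≈-ren ρ e ⊕ ≈-ren ρ f
≈-ren ρ (e ∥ f)                   = ≈-ren ρ e ∥ ≈-ren ρ f
≈-ren ρ (ν e)                     = ν ≈-ren (ext ρ) e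
≈-ren ρ (! e)                     = ! ≈-ren ρ e
≈-ren ρ ([ refl ≐ refl ] e)       = [ refl ≐ refl ] ≈-ren ρ e

≈-νs : ∀ k {P Q} → P ≈ Q → νs k P ≈ νs k Q
≈-νs zero    e = e
≈-νs (suc k) e = ν ≈-νs k e

≈-step : ∀ {A α A' B} → A —[ α ]→ A' → A ≈ B → ∃ λ B' → B —[ α ]→ B' × A' ≈ B'
≈-step tau          (τ· e)           = _ , tau , e
≈-step output       (out refl refl e) = _ , output , e
≈-step (input σ m)  (inp refl refl e) = _ , input σ m , ≈-ren _ e
≈-step (sumL t)     (e ⊕ f) with ≈-step t e
... | _ , u , e' = _ , sumL u , e'
≈-step (sumR t)     (e ⊕ f) with ≈-step t f
... | _ , u , f' = _ , sumR u , f'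
≈-step (parL t)     (e ∥ f) with ≈-step t e
... | _ , u , e' = _ , parL u , e' ∥ ≈-ren _ f
≈-step (parR t)     (e ∥ f) with ≈-step t f
... | _ , u , f' = _ , parR u , ≈-ren _ e ∥ f'
≈-step (commL {k = k} t₁ t₂) (e ∥ f) with ≈-step t₁ e | ≈-step t₂ (≈-ren (shift k) f)
... | _ , u₁ , e' | _ , u₂ , f' = _ , commL u₁ u₂ , ≈-νs k (e' ∥ f')
≈-step (commR {k = k} t₁ t₂) (e ∥ f) with ≈-step t₁ f | ≈-step t₂ (≈-ren (shift k) e)
... | _ , u₁ , f' | _ , u₂ , e' = _ , commR u₁ u₂ , ≈-νs k (e' ∥ f')
≈-step (resτ t)     (ν e) with ≈-step t e
... | _ , u , e' = _ , resτ u , ν e'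
≈-step (resIn t)    (ν e) with ≈-step t e
... | _ , u , e' = _ , resIn u , ν e'
≈-step (resOut {k = k} t) (ν e) with ≈-step t e
... | _ , u , e' = _ , resOut u , ν ≈-ren (rot k) e'
≈-step (open′ t a)  (ν e) with ≈-step t e
... | _ , u , e' = _ , open′ u a , e'
≈-step (rep t)      (! e) with ≈-step t (e ∥ (! e))
... | _ , u , e' = _ , rep u , e'
≈-step (match t)    ([ refl ≐ refl ] e) with ≈-step t e
... | _ , u , e' = _ , match u , e'

FixesBelow : ℕ → (ℕ → ℕ) → Set
FixesBelow n ρ = ∀ {i} → i < n → ρ i ≡ i

ext-fixesBelow : ∀ {n ρ} → FixesBelow n ρ → FixesBelow (suc n) (ext ρ)
ext-fixesBelow f {zero}  _       = refl
ext-fixesBelow f {suc i} (s≤s p) = cong suc (f p)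

extN-fixesBelow : ∀ k {n ρ} → FixesBelow n ρ → FixesBelow (k + n) (extN k ρ)
extN-fixesBelow zero    f = f
extN-fixesBelow (suc k) f = ext-fixesBelow (extN-fixesBelow k f)

map⁺-id-local : ∀ {ρ : ℕ → ℕ} (a : List⁺ ℕ) → All (λ i → ρ i ≡ i) (toList a) → L⁺.map ρ a ≡ a
map⁺-id-local (x L⁺.∷ xs) (p ∷ ps) = cong₂ L⁺._∷_ p (map-id-local ps)

renEl-fixesBelow : ∀ {k n ρ} → FixesBelow n ρ → {e : PatEl k} → ScopedEl n e → renEl ρ e ≡ e
renEl-fixesBelow f {mark m} p = cong mark (f p)
renEl-fixesBelow f {var j}  _ = refl

ren-fixesBelow : ∀ {n ρ P} → FixesBelow n ρ → Scoped n P → ren ρ P ≈ P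
ren-fixesBelow f 𝟘             = 𝟘
ren-fixesBelow f (τ· s)        = τ· ren-fixesBelow f s
ren-fixesBelow f (out {a = a} sa sb s) =
  out (map⁺-id-local a (All.map f sa)) (map-id-local (All.map f sb)) (ren-fixesBelow f s)
ren-fixesBelow f (inp {a = a} {k = k} sa sp s) =
  inp (map⁺-id-local a (All.map f sa)) (map-id-local (All.map (renEl-fixesBelow f) sp))
      (ren-fixesBelow (extN-fixesBelow k f) s)
ren-fixesBelow f (s ⊕ t)       = ren-fixesBelow f s ⊕ ren-fixesBelow f t
ren-fixesBelow f (s ∥ t)       = ren-fixesBelow f s ∥ ren-fixesBelow f t
ren-fixesBelow f (ν s)         = ν ren-fixesBelow (ext-fixesBelow f) s
ren-fixesBelow f (! s)         = ! ren-fixesBelow f s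
ren-fixesBelow f ([ p ≐ q ] s) = [ f p ≐ f q ] ren-fixesBelow f s

ren-closed : ∀ ρ {I} → Closed I → ren ρ I ≈ I
ren-closed ρ = ren-fixesBelow (λ ())

ext-id : ∀ {ρ} → ρ ≗ id → ext ρ ≗ id
ext-id f zero    = refl
ext-id f (suc i) = cong suc (f i)

extN-id : ∀ k {ρ} → ρ ≗ id → extN k ρ ≗ id
extN-id zero    f = f
extN-id (suc k) f = ext-id (extN-id k f)

renEl-id : ∀ {k ρ} → ρ ≗ id → renEl {k} ρ ≗ id
renEl-id f (mark m) = cong mark (f m)
renEl-id f (var j)  = refl

ren-id : ∀ {ρ} → ρ ≗ id → ∀ P → ren ρ P ≈ P
ren-id f 𝟘                 = 𝟘
ren-id f (τ· P)            = τ· ren-id f P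
ren-id f (out a b P)       =
  out (trans (L⁺.map-cong f a) (L⁺.map-id a)) (trans (map-cong f b) (map-id b)) (ren-id f P)
ren-id f (inp a k pat c P) =
  inp (trans (L⁺.map-cong f a) (L⁺.map-id a)) (trans (map-cong (renEl-id f) pat) (map-id pat))
      (ren-id (extN-id k f) P)
ren-id f (P ⊕ Q)           = ren-id f P ⊕ ren-id f Q
ren-id f (P ∥ Q)           = ren-id f P ∥ ren-id f Q
ren-id f (ν P)             = ν ren-id (ext-id f) P
ren-id f (! P)             = ! ren-id f P
ren-id f ([ n ≐ m ] P)     = [ f n ≐ f m ] ren-id f P

MapsBelow : ℕ → ℕ → (ℕ → ℕ) → Set
MapsBelow m n ρ = ∀ {i} → i < m → ρ i < n

ext-mapsBelow : ∀ {m n ρ} → MapsBelow m n ρ → MapsBelow (suc m) (suc n) (ext ρ)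
ext-mapsBelow h {zero}  _       = s≤s z≤n
ext-mapsBelow h {suc i} (s≤s p) = s≤s (h p)

extN-mapsBelow : ∀ k {m n ρ} → MapsBelow m n ρ → MapsBelow (k + m) (k + n) (extN k ρ)
extN-mapsBelow zero    h = h
extN-mapsBelow (suc k) h = ext-mapsBelow (extN-mapsBelow k h)

shift-mapsBelow : ∀ k {n} → MapsBelow n (k + n) (shift k)
shift-mapsBelow k = +-monoʳ-< k

map⁺-scoped : ∀ {m n ρ} (a : List⁺ ℕ) → MapsBelow m n ρ →
              All (_< m) (toList a) → All (_< n) (toList (L⁺.map ρ a))
map⁺-scoped (x L⁺.∷ xs) h (p ∷ ps) = h p ∷ map⁺ (All.map h ps)

renEl-scoped : ∀ {k m n ρ} → MapsBelow m n ρ → {e : PatEl k} → ScopedEl m e → ScopedEl n (renEl ρ e)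
renEl-scoped h {mark x} p = h p
renEl-scoped h {var j}  _ = tt

scoped-ren : ∀ {m n ρ P} → MapsBelow m n ρ → Scoped m P → Scoped n (ren ρ P)
scoped-ren h 𝟘             = 𝟘
scoped-ren h (τ· s)        = τ· scoped-ren h s
scoped-ren h (out {a = a} sa sb s) =
  out (map⁺-scoped a h sa) (map⁺ (All.map h sb)) (scoped-ren h s)
scoped-ren h (inp {a = a} {k = k} sa sp s) =
  inp (map⁺-scoped a h sa) (map⁺ (All.map (renEl-scoped h) sp)) (scoped-ren (extN-mapsBelow k h) s)
scoped-ren h (s ⊕ t)       = scoped-ren h s ⊕ scoped-ren h t
scoped-ren h (s ∥ t)       = scoped-ren h s ∥ scoped-ren h t
scoped-ren h (ν s)         = ν scoped-ren (ext-mapsBelow h) s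
scoped-ren h (! s)         = ! scoped-ren h s
scoped-ren h ([ p ≐ q ] s) = [ h p ≐ h q ] scoped-ren h s

scoped-νs : ∀ k {n P} → Scoped (k + n) P → Scoped n (νs k P)
scoped-νs zero            s = s
scoped-νs (suc k) {n} {P} s = ν scoped-νs k (subst (λ m → Scoped m P) (sym (+-suc k n)) s)

matched-scoped : ∀ {k n} {σ : Fin k → ℕ} {pat b j} → Match σ pat b → All (_< n) b →
                 Any (var j ≡_) pat → σ j < n
matched-scoped {n = n} (b≡σj ∷ _) (p ∷ _)  (here refl) = subst (_< n) b≡σj p
matched-scoped         (_ ∷ m)    (_ ∷ ps) (there a)   = matched-scoped m ps a

inst-mapsBelow : ∀ k {n} (σ : Fin k → ℕ) → (∀ j → σ j < n) → MapsBelow (k + n) n (inst k σ)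
inst-mapsBelow zero    σ h         p       = p
inst-mapsBelow (suc k) σ h {zero}  _       = h F.zero
inst-mapsBelow (suc k) σ h {suc i} (s≤s p) = inst-mapsBelow k (λ j → σ (F.suc j)) (λ j → h (F.suc j)) p

rot-mapsBelow : ∀ k {n} → MapsBelow (k + suc n) (suc (k + n)) (rot k)
rot-mapsBelow zero                p       = p
rot-mapsBelow (suc k) {i = zero}  _       = s≤s (s≤s z≤n)
rot-mapsBelow (suc k) {i = suc i} (s≤s p) with rot k i | rot-mapsBelow k {i = i} p
... | zero  | _ = s≤s z≤n
... | suc _ | q = s≤s q

<-liftAt⁻ : ∀ k {n} x → liftAt k x < k + suc n → x < k + n
<-liftAt⁻ zero    x       (s≤s p) = p
<-liftAt⁻ (suc k) zero    _       = s≤s z≤n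
<-liftAt⁻ (suc k) (suc x) (s≤s p) = s≤s (<-liftAt⁻ k x p)

-- A derivative of a process scoped in n is scoped provided received names are
-- in scope, and the names sent by an output are then in scope as well; in a
-- communication the second fact supplies the first.
ReceivedIn : ℕ → Act → Set
ReceivedIn n (inA a b) = All (_< n) b
ReceivedIn n _         = ⊤

SentIn : ℕ → Act → Set
SentIn n (outA k a b) = All (_< k + n) b
SentIn n _            = ⊤

scoped-step : ∀ {n P α P'} → Scoped n P → P —[ α ]→ P' → ReceivedIn n α →
              Scoped (bn α + n) P' × SentIn n α
scoped-step (τ· s)        tau         _ = s , tt
scoped-step (out _ sb s)  output      _ = s , sb
scoped-step (inp {k = k} _ _ s) (input {c = c} σ m) rb =
  scoped-ren (inst-mapsBelow k σ (λ j → matched-scoped m rb (c j))) s , tt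
scoped-step (s ⊕ t)       (sumL u)    rb = scoped-step s u rb
scoped-step (s ⊕ t)       (sumR u)    rb = scoped-step t u rb
scoped-step (s ∥ t) (parL {α = α} u) rb with scoped-step s u rb
... | s' , sb = s' ∥ scoped-ren (shift-mapsBelow (bn α)) t , sb
scoped-step (s ∥ t) (parR {α = α} u) rb with scoped-step t u rb
... | t' , sb = scoped-ren (shift-mapsBelow (bn α)) s ∥ t' , sb
scoped-step (s ∥ t) (commL {k = k} u₁ u₂) _ with scoped-step s u₁ tt
... | s' , sb with scoped-step (scoped-ren (shift-mapsBelow k) t) u₂ sb
... | t' , _ = scoped-νs k (s' ∥ t') , tt
scoped-step (s ∥ t) (commR {k = k} u₁ u₂) _ with scoped-step t u₁ tt
... | t' , sb with scoped-step (scoped-ren (shift-mapsBelow k) s) u₂ sb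
... | s' , _ = scoped-νs k (s' ∥ t') , tt
scoped-step (ν s) (resτ u) _ with scoped-step s u tt
... | s' , _ = ν s' , tt
scoped-step (ν s) (resIn u) rb with scoped-step s u (map⁺ (All.map s≤s rb))
... | s' , _ = ν s' , tt
scoped-step (ν s) (resOut {k = k} u) _ with scoped-step s u tt
... | s' , sb = ν scoped-ren (rot-mapsBelow k) s' , All.map (λ {x} → <-liftAt⁻ k x) (map⁻ sb)
scoped-step {n} (ν s) (open′ {P' = P'} {k = k} {b = b} u _) _ with scoped-step s u tt
... | s' , sb = subst (λ m → Scoped m P') (+-suc k n) s' , subst (λ m → All (_< m) b) (+-suc k n) sb
scoped-step (! s)          (rep u)   rb = scoped-step (s ∥ (! s)) u rb
scoped-step ([ _ ≐ _ ] s)  (match u) rb = scoped-step s u rb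

closed-τ-step : ∀ {I I'} → Closed I → I —[ τ ]→ I' → Closed I'
closed-τ-step c t with scoped-step c t tt
... | c' , _ = c'

⇓-intro : ∀ {P Q α Q'} → P ⇒ Q → Q —[ α ]→ Q' → Visible α → P ⇓
⇓-intro s t v = _ , _ , _ , _ , s , t , v , ε

invisible-τ-step : ∀ {I I'} → Invisible I → I —[ τ ]→ I' → Invisible I'
invisible-τ-step inv t (Q , α , Q' , P' , s , u , v , s') = inv (Q , α , Q' , P' , t ◅ s , u , v , s')

-- Replaced A B : B arises from A by replacing subprocesses ≈ closed invisible
-- processes with arbitrary ones.  The pending constructors record a choice
-- (a summand, a satisfied match, an unfolding of !) already made by a τ-step
-- inside a replaced process on the left, which the right side makes only when
-- it moves.
data Replaced : Proc → Proc → Set where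
  inert  : ∀ {A I X} → Closed I → Invisible I → A ≈ I → Replaced A X
  𝟘      : Replaced 𝟘 𝟘
  τ·_    : ∀ {P Q} → Replaced P Q → Replaced (τ· P) (τ· Q)
  out    : ∀ {a b P Q} → Replaced P Q → Replaced (out a b P) (out a b Q)
  inp    : ∀ {a k pat c c' P Q} → Replaced P Q → Replaced (inp a k pat c P) (inp a k pat c' Q)
  _⊕_    : ∀ {P P' Q Q'} → Replaced P P' → Replaced Q Q' → Replaced (P ⊕ Q) (P' ⊕ Q')
  _∥_    : ∀ {P P' Q Q'} → Replaced P P' → Replaced Q Q' → Replaced (P ∥ Q) (P' ∥ Q')
  ν_     : ∀ {P Q} → Replaced P Q → Replaced (ν P) (ν Q)
  !_     : ∀ {P Q} → Replaced P Q → Replaced (! P) (! Q)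
  [≐]_   : ∀ {n m P Q} → Replaced P Q → Replaced ([ n ≐ m ] P) ([ n ≐ m ] Q)
  ⊕ˡ-pending : ∀ {A B₁ B₂} → Replaced A B₁ → Replaced A (B₁ ⊕ B₂)
  ⊕ʳ-pending : ∀ {A B₁ B₂} → Replaced A B₂ → Replaced A (B₁ ⊕ B₂)
  ≐-pending  : ∀ {A B n} → Replaced A B → Replaced A ([ n ≐ n ] B)
  !-pending  : ∀ {A B} → Replaced A (B ∥ (! B)) → Replaced A (! B)

replaced-νs : ∀ k {P Q} → Replaced P Q → Replaced (νs k P) (νs k Q)
replaced-νs zero    r = r
replaced-νs (suc k) r = ν replaced-νs k r

replaced-refl : ∀ P → Replaced P P
replaced-refl 𝟘                 = 𝟘
replaced-refl (τ· P)            = τ· replaced-refl P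
replaced-refl (out a b P)       = out (replaced-refl P)
replaced-refl (inp a k pat c P) = inp (replaced-refl P)
replaced-refl (P ⊕ Q)           = replaced-refl P ⊕ replaced-refl Q
replaced-refl (P ∥ Q)           = replaced-refl P ∥ replaced-refl Q
replaced-refl (ν P)             = ν replaced-refl P
replaced-refl (! P)             = ! replaced-refl P
replaced-refl ([ n ≐ m ] P)     = [≐] replaced-refl P

ctx-replaced : ∀ C {I P} → Closed I → Invisible I → Replaced (C [ I ]) (C [ P ])
ctx-replaced ∙                  c inv = inert c inv ≈-refl
ctx-replaced (τ· C)             c inv = τ· ctx-replaced C c inv
ctx-replaced (out a b C)        c inv = out (ctx-replaced C c inv)
ctx-replaced (inp a k pat cv C) c inv = inp (ctx-replaced C c inv)
ctx-replaced (C ⊕ˡ Q)           c inv = ctx-replaced C c inv ⊕ replaced-refl Q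
ctx-replaced (Q ⊕ʳ C)           c inv = replaced-refl Q ⊕ ctx-replaced C c inv
ctx-replaced (C ∥ˡ Q)           c inv = ctx-replaced C c inv ∥ replaced-refl Q
ctx-replaced (Q ∥ʳ C)           c inv = replaced-refl Q ∥ ctx-replaced C c inv
ctx-replaced (ν C)              c inv = ν ctx-replaced C c inv
ctx-replaced (! C)              c inv = ! ctx-replaced C c inv
ctx-replaced ([ n ≐ m ] C)      c inv = [≐] ctx-replaced C c inv

replaced-ren : ∀ ρ {A B} → Replaced A B → Replaced (ren ρ A) (ren ρ B)
replaced-ren ρ (inert c inv e) = inert c inv (≈-trans (≈-ren ρ e) (ren-closed ρ c))
replaced-ren ρ 𝟘               = 𝟘
replaced-ren ρ (τ· r)          = τ· replaced-ren ρ r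
replaced-ren ρ (out r)         = out (replaced-ren ρ r)
replaced-ren ρ (inp {k = k} r) = inp (replaced-ren (extN k ρ) r)
replaced-ren ρ (r ⊕ s)         = replaced-ren ρ r ⊕ replaced-ren ρ s
replaced-ren ρ (r ∥ s)         = replaced-ren ρ r ∥ replaced-ren ρ s
replaced-ren ρ (ν r)           = ν replaced-ren (ext ρ) r
replaced-ren ρ (! r)           = ! replaced-ren ρ r
replaced-ren ρ ([≐] r)         = [≐] replaced-ren ρ r
replaced-ren ρ (⊕ˡ-pending r)  = ⊕ˡ-pending (replaced-ren ρ r)
replaced-ren ρ (⊕ʳ-pending r)  = ⊕ʳ-pending (replaced-ren ρ r)
replaced-ren ρ (≐-pending r)   = ≐-pending (replaced-ren ρ r)
replaced-ren ρ (!-pending r)   = !-pending (replaced-ren ρ r)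

replaced-respˡ : ∀ {A A' B} → A' ≈ A → Replaced A B → Replaced A' B
replaced-respˡ e                  (inert c inv e') = inert c inv (≈-trans e e')
replaced-respˡ 𝟘                  𝟘                = 𝟘
replaced-respˡ (τ· e)             (τ· r)           = τ· replaced-respˡ e r
replaced-respˡ (out refl refl e)  (out r)          = out (replaced-respˡ e r)
replaced-respˡ (inp refl refl e)  (inp r)          = inp (replaced-respˡ e r)
replaced-respˡ (e ⊕ f)            (r ⊕ s)          = replaced-respˡ e r ⊕ replaced-respˡ f s
replaced-respˡ (e ∥ f)            (r ∥ s)          = replaced-respˡ e r ∥ replaced-respˡ f s
replaced-respˡ (ν e)              (ν r)            = ν replaced-respˡ e r
replaced-respˡ (! e)              (! r)            = ! replaced-respˡ e r
replaced-respˡ ([ refl ≐ refl ] e) ([≐] r)         = [≐] replaced-respˡ e r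
replaced-respˡ e                  (⊕ˡ-pending r)   = ⊕ˡ-pending (replaced-respˡ e r)
replaced-respˡ e                  (⊕ʳ-pending r)   = ⊕ʳ-pending (replaced-respˡ e r)
replaced-respˡ e                  (≐-pending r)    = ≐-pending (replaced-respˡ e r)
replaced-respˡ e                  (!-pending r)    = !-pending (replaced-respˡ e r)

Answered : Act → Proc → Proc → Set
Answered α A' B = (α ≡ τ × Replaced A' B) ⊎ (∃ λ B' → B —[ α ]→ B' × Replaced A' B')

answered-wrap : ∀ {α A' B C} → (Replaced A' B → Replaced A' C) →
                (∀ {B'} → B —[ α ]→ B' → C —[ α ]→ B') → Answered α A' B → Answered α A' C
answered-wrap w s (inj₁ (eq , r))     = inj₁ (eq , w r)
answered-wrap w s (inj₂ (B' , u , r)) = inj₂ (B' , s u , r)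

answer-visible : ∀ {α A' B} → Visible α → Answered α A' B →
                 ∃ λ B' → B —[ α ]→ B' × Replaced A' B'
answer-visible vis (inj₁ (τ≡ , _)) = ⊥-elim (vis τ≡)
answer-visible vis (inj₂ answer)   = answer

inert-step : ∀ {A α A' I X} → Closed I → Invisible I → A ≈ I → A —[ α ]→ A' → Answered α A' X
inert-step {α = α} c inv e t with ≈-step t e
... | _ , u , e' with α
...   | τ          = inj₁ (refl , inert (closed-τ-step c u) (invisible-τ-step inv u) e')
...   | inA _ _    = ⊥-elim (inv (⇓-intro ε u (λ ())))
...   | outA _ _ _ = ⊥-elim (inv (⇓-intro ε u (λ ())))

replaced-step : ∀ {A B α A'} → A —[ α ]→ A' → Replaced A B → Answered α A' B
replaced-step t (inert c inv e)  = inert-step c inv e t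
replaced-step t (⊕ˡ-pending r)   = answered-wrap ⊕ˡ-pending sumL (replaced-step t r)
replaced-step t (⊕ʳ-pending r)   = answered-wrap ⊕ʳ-pending sumR (replaced-step t r)
replaced-step t (≐-pending r)    = answered-wrap ≐-pending match (replaced-step t r)
replaced-step t (!-pending r)    = answered-wrap !-pending rep (replaced-step t r)
replaced-step tau         (τ· r) = inj₂ (_ , tau , r)
replaced-step output      (out r) = inj₂ (_ , output , r)
replaced-step (input σ m) (inp r) = inj₂ (_ , input σ m , replaced-ren _ r)
replaced-step (sumL t)    (r ⊕ s) = answered-wrap ⊕ˡ-pending sumL (replaced-step t r)
replaced-step (sumR t)    (r ⊕ s) = answered-wrap ⊕ʳ-pending sumR (replaced-step t s)
replaced-step (match t)   ([≐] r) = answered-wrap ≐-pending match (replaced-step t r)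
replaced-step (rep t)     (! r)   = answered-wrap !-pending rep (replaced-step t (r ∥ (! r)))
-- After a τ-step the idle component is renamed by shift 0, the identity only
-- pointwise.
replaced-step (parL t) (r ∥ s) with replaced-step t r
... | inj₁ (refl , r')  = inj₁ (refl , r' ∥ replaced-respˡ (ren-id (λ _ → refl) _) s)
... | inj₂ (_ , u , r') = inj₂ (_ , parL u , r' ∥ replaced-ren _ s)
replaced-step (parR t) (r ∥ s) with replaced-step t s
... | inj₁ (refl , s')  = inj₁ (refl , replaced-respˡ (ren-id (λ _ → refl) _) r ∥ s')
... | inj₂ (_ , u , s') = inj₂ (_ , parR u , replaced-ren _ r ∥ s')
replaced-step (commL {k = k} t₁ t₂) (r ∥ s)
  with answer-visible (λ ()) (replaced-step t₁ r)
     | answer-visible (λ ()) (replaced-step t₂ (replaced-ren (shift k) s))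
... | _ , u₁ , r' | _ , u₂ , s' = inj₂ (_ , commL u₁ u₂ , replaced-νs k (r' ∥ s'))
replaced-step (commR {k = k} t₁ t₂) (r ∥ s)
  with answer-visible (λ ()) (replaced-step t₁ s)
     | answer-visible (λ ()) (replaced-step t₂ (replaced-ren (shift k) r))
... | _ , u₁ , s' | _ , u₂ , r' = inj₂ (_ , commR u₁ u₂ , replaced-νs k (r' ∥ s'))
replaced-step (resτ t) (ν r) with replaced-step t r
... | inj₁ (refl , r')  = inj₁ (refl , ν r')
... | inj₂ (_ , u , r') = inj₂ (_ , resτ u , ν r')
replaced-step (resIn t) (ν r) with answer-visible (λ ()) (replaced-step t r)
... | _ , u , r' = inj₂ (_ , resIn u , ν r')
replaced-step (resOut {k = k} t) (ν r) with answer-visible (λ ()) (replaced-step t r)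
... | _ , u , r' = inj₂ (_ , resOut u , ν replaced-ren (rot k) r')
replaced-step (open′ t a) (ν r) with answer-visible (λ ()) (replaced-step t r)
... | _ , u , r' = inj₂ (_ , open′ u a , r')

replaced-steps : ∀ {A A₁ B} → A ⇒ A₁ → Replaced A B → ∃ λ B₁ → B ⇒ B₁ × Replaced A₁ B₁
replaced-steps ε       r = _ , ε , r
replaced-steps (t ◅ s) r with replaced-step t r
... | inj₁ (refl , r')   = replaced-steps s r'
... | inj₂ (_ , u , r') with replaced-steps s r'
...   | _ , s' , r''     = _ , u ◅ s' , r''

replacementFree : ReplacementFree
replacementFree C I P c inv (_ , _ , _ , _ , s , t , vis , _)
  with replaced-steps s (ctx-replaced C {P = P} c inv)
... | _ , s' , r with answer-visible vis (replaced-step t r)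
...   | _ , u , _ = ⇓-intro s' u vis

Stuck : Proc → Set
Stuck P = ∀ {α X} → ¬ (P —[ α ]→ X)

stuck-invisible : ∀ {P} → Stuck P → Invisible P
stuck-invisible stuck (_ , _ , _ , _ , ε ,     t , _) = stuck t
stuck-invisible stuck (_ , _ , _ , _ , t ◅ _ , _ , _) = stuck t

-- In named syntax C₀ = (νa)(a(x).[·] | ā⟨b⟩) and I₀ = [x = b] b̄⟨⟩ with b
-- free; inside the hole the de Bruijn indices are x = 0, a = 1, b = 2.
C₀ : Ctx
C₀ = ν (inp (0 L⁺.∷ []) 1 (var F.zero ∷ []) covers ∙ ∥ˡ out (0 L⁺.∷ []) (1 ∷ []) 𝟘)
  where
  covers : Covers {1} (var F.zero ∷ [])
  covers F.zero = here refl

I₀ : Proc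
I₀ = [ 0 ≐ 2 ] out (2 L⁺.∷ []) [] 𝟘

I₀-stuck : Stuck I₀
I₀-stuck ()

C₀[I₀]⇓ : (C₀ [ I₀ ]) ⇓
C₀[I₀]⇓ = ⇓-intro (resτ (commR output (input (λ _ → 1) (refl ∷ []))) ◅ ε)
                  (resOut {b = []} (parL (match output))) (λ ())

C₀[𝟘]-step : ∀ {α X} → C₀ [ 𝟘 ] —[ α ]→ X → α ≡ τ × X ≡ ν (𝟘 ∥ 𝟘)
C₀[𝟘]-step (resτ (parL ()))
C₀[𝟘]-step (resτ (parR ()))
C₀[𝟘]-step (resτ (commL () _))
C₀[𝟘]-step (resτ (commR output (input _ _))) = refl , refl
C₀[𝟘]-step (resIn (parL ()))
C₀[𝟘]-step (resIn (parR ()))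
C₀[𝟘]-step (resOut (parL ()))
C₀[𝟘]-step (resOut (parR ()))
C₀[𝟘]-step (open′ (parL ()) _)
C₀[𝟘]-step (open′ (parR ()) _)

ν𝟘∥𝟘-stuck : Stuck (ν (𝟘 ∥ 𝟘))
ν𝟘∥𝟘-stuck (resτ (parL ()))
ν𝟘∥𝟘-stuck (resτ (parR ()))
ν𝟘∥𝟘-stuck (resτ (commL () _))
ν𝟘∥𝟘-stuck (resτ (commR () _))
ν𝟘∥𝟘-stuck (resIn (parL ()))
ν𝟘∥𝟘-stuck (resIn (parR ()))
ν𝟘∥𝟘-stuck (resOut (parL ()))
ν𝟘∥𝟘-stuck (resOut (parR ()))
ν𝟘∥𝟘-stuck (open′ (parL ()) _)
ν𝟘∥𝟘-stuck (open′ (parR ()) _)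

C₀[𝟘]-invisible : Invisible (C₀ [ 𝟘 ])
C₀[𝟘]-invisible (_ , _ , _ , _ , ε , t , vis , _) with C₀[𝟘]-step t
... | τ≡ , _ = vis τ≡
C₀[𝟘]-invisible (_ , _ , _ , _ , t ◅ s , u , vis , s') with C₀[𝟘]-step t
... | refl , refl = stuck-invisible ν𝟘∥𝟘-stuck (_ , _ , _ , _ , s , u , vis , s')

¬stronglyReplacementFree : ¬ StronglyReplacementFree
¬stronglyReplacementFree srf =
  C₀[𝟘]-invisible (srf C₀ I₀ 𝟘 (stuck-invisible I₀-stuck) C₀[I₀]⇓)

theorem4p4 : WeaklyReplacementFree
theorem4p4 = replacementFree , ¬stronglyReplacementFree
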